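{- Let $\ell \geq 2$ and let $p^k_{n,\ell}$ denote the number of (strong) independent sets of size $k$ in $P_{n,\ell}$. Then: (a) $p^k_{0,\ell}=1$ if $k=0$ and $p^k_{0,\ell}=0$ if $k>0$; (b) $p^0_{1,\ell}=1$, $p^1_{1,\ell}=\ell$, and $p^k_{1,\ell}=0$ for $k\ge 2$; (c) $p^0_{n,\ell}=1$ for all $n\ge 0$; (d) $p^1_{0,\ell}=0$ and $p^1_{n,\ell}=n\ell-(n-1)$ for $n>0$; (e) for all $n\ge 2$ and $k\ge 2$, $$p^k_{n,\ell}=(\ell-1)^2\sum_{j=0}^{k-2}(\ell-2)^{k-j-2}\binom{k-2}{j}\binom{n-j}{k}.$$ Moreover, for all $n\ge 3$, $k\ge 1$ and $\ell\ge 2$, $$p^k_{n,\ell}=p^k_{n-1,\ell}+p^{k-1}_{n-2,\ell}+(\ell-2)p^{k-1}_{n-1,\ell}.$$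
   Context: A (strong) independent set in a hypergraph is a set of vertices containing at most one vertex from each edge. For $n\ge 1$ and $\ell\ge 2$, $P_{n,\ell}$ is the $\ell$-uniform, $n$-edge linear hyperpath: it has $n$ edges $e_1,\ldots,e_n$ each of size $\ell$, with $e_i$ and $e_{i+1}$ sharing exactly one vertex for each $i<n$, and no other pairs of edges sharing a vertex. $P_{0,\ell}$ is the empty hypergraph (whose only independent set is the empty set). The convention $0^0=1$ is used in the summation formula (relevant when $\ell=2$), and binomial coefficients $\binom{a}{b}$ with $0\le a<b$ are $0$. -}

module Defs where

open import Data.Bool using (Bool; true; false; _∧_; if_then_else_)
open import Data.Nat using (ℕ; zero; suc; _+_; _*_; _∸_; _≤ᵇ_; _≡ᵇ_)
open import Data.Fin using (Fin; toℕ)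
open import Data.List using (List; []; _∷_; map; _++_; length; filterᵇ; upTo; allFin)
open import Data.Bool.ListAction using (all)
open import Data.Nat.ListAction using (sum)
open import Data.Vec using (Vec; []; _∷_; lookup)

record Hypergraph : Set where
  field
    nV    : ℕ
    edges : List (List (Fin nV))
open Hypergraph public

Subset : ℕ → Set
Subset m = Vec Bool m

allSubsets : (m : ℕ) → List (Subset m)
allSubsets zero    = [] ∷ []
allSubsets (suc m) = map (true ∷_) (allSubsets m) ++ map (false ∷_) (allSubsets m)

size : ∀ {m} → Subset m → ℕ
size []          = 0
size (true ∷ s)  = suc (size s)
size (false ∷ s) = size s

countIn : ∀ {m} → Subset m → List (Fin m) → ℕ
countIn S e = length (filterᵇ (lookup S) e)

isIndependent : (H : Hypergraph) → Subset (nV H) → Bool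
isIndependent H S = all (λ e → countIn S e ≤ᵇ 1) (edges H)

numIndep : Hypergraph → ℕ → ℕ
numIndep H k =
  length (filterᵇ (λ S → isIndependent H S ∧ (size S ≡ᵇ k)) (allSubsets (nV H)))

-- The linear ℓ-uniform hyperpath P_{n,ℓ}:
-- vertices 0 .. nℓ-(n-1)-1 (none when n = 0);
-- edge e_i (0 ≤ i < n) = { i(ℓ-1), i(ℓ-1)+1, ..., i(ℓ-1)+(ℓ-1) }.
-- So e_i and e_{i+1} share exactly the vertex (i+1)(ℓ-1) (for ℓ ≥ 2).
pathVertices : ℕ → ℕ → ℕ
pathVertices n ℓ = n * ℓ ∸ (n ∸ 1)

inEdge : ℕ → ℕ → ℕ → Bool
inEdge ℓ i v = (i * (ℓ ∸ 1) ≤ᵇ v) ∧ (v ≤ᵇ i * (ℓ ∸ 1) + (ℓ ∸ 1))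

hyperpath : ℕ → ℕ → Hypergraph
hyperpath n ℓ = record
  { nV    = pathVertices n ℓ
  ; edges = map (λ i → filterᵇ (λ v → inEdge ℓ i (toℕ v)) (allFin (pathVertices n ℓ))) (upTo n)
  }

p : ℕ → ℕ → ℕ → ℕ
p k n ℓ = numIndep (hyperpath n ℓ) k

open import Data.Nat using (_^_)
open import Data.Nat.Combinatorics using (_C_)

formulaSum : ℕ → ℕ → ℕ → ℕ
formulaSum n k ℓ =
  sum (map (λ j → (ℓ ∸ 2) ^ (k ∸ j ∸ 2) * ((k ∸ 2) C j) * ((n ∸ j) C k)) (upTo (k ∸ 1)))

-- An independent set of P_{n,ℓ} is a 0/1-string on the vertices 0, …, n(ℓ − 1) with at most one 1 in
-- each window {i(ℓ − 1), …, (i + 1)(ℓ − 1)}. Reading such a string from vertex 0, the first edge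
-- contributes either one of its ℓ − 1 private vertices, which excludes the vertex it shares with the
-- rest of the path, or none of them. Together with the count of sets avoiding the first vertex this
-- gives a linear recurrence in n, from which the three-term recurrence follows by eliminating the
-- auxiliary count, and the closed form by induction using Pascal's rule in both binomial parameters.
module Submission where

open import Defs
open import Data.Bool using (Bool; true; false; _∧_; T)
open import Data.Bool.Properties using (∧-zeroʳ)
open import Data.Bool.ListAction using (all; and)
open import Data.Nat using (ℕ; zero; suc; _+_; _*_; _∸_; _^_; _≤ᵇ_; _<ᵇ_; _≡ᵇ_; _<_; _≥_; _>_; s≤s)
open import Data.Nat.Properties
  using (+-assoc; +-comm; +-suc; +-identityʳ; *-suc; *-identityˡ; *-zeroʳ; *-distribˡ-+; +-*-semiring;
         m+n∸m≡n; ∸-+-assoc; +-∸-assoc; 0∸n≡0; n<1+n)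
open import Data.Nat.Combinatorics using (_C_; nCk+nC[k+1]≡[n+1]C[k+1]; k>n⇒nCk≡0; nC1≡n)
open import Data.Nat.ListAction using (sum)
open import Data.Nat.Tactic.RingSolver using (solve-∀)
open import Data.Fin as Fin using (Fin; toℕ)
open import Data.Fin.Properties using (toℕ<n; toℕ-inject₁; toℕ-fromℕ)
open import Data.List using ([]; _∷_; map; _++_; length; filterᵇ; tabulate; applyUpTo; upTo; allFin)
open import Data.List.Properties using (length-++; filter-++; filter-none; filter-≐; map-cong; map-∘; map-applyUpTo)
import Data.List.Relation.Unary.All as All
open import Data.Product using (_×_; _,_)
open import Data.Vec using ([]; _∷_; lookup)
open import Function using (_∘_)
open import Relation.Nullary.Decidable using (T?)
open import Relation.Binary.PropositionalEquality
open import Algebra.Properties.Semiring.Sum +-*-semiring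
  using (sum-syntax; sum⁺-syntax; sum-cong-≗; ∑-distrib-+; *-distribˡ-sum; sum-init-last; sum-replicate-zero)
open ≡-Reasoning

private
  variable
    A B : Set

bit : Bool → ℕ
bit true  = 1
bit false = 0

length-filterᵇ-∷ : ∀ (P : A → Bool) x xs →
  length (filterᵇ P (x ∷ xs)) ≡ bit (P x) + length (filterᵇ P xs)
length-filterᵇ-∷ P x xs with P x
... | true  = refl
... | false = refl

length-filterᵇ-++ : ∀ (P : A → Bool) xs ys →
  length (filterᵇ P (xs ++ ys)) ≡ length (filterᵇ P xs) + length (filterᵇ P ys)
length-filterᵇ-++ P xs ys = trans (cong length (filter-++ (T? ∘ P) xs ys)) (length-++ (filterᵇ P xs))

length-filterᵇ-map : ∀ (P : B → Bool) (f : A → B) xs →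
  length (filterᵇ P (map f xs)) ≡ length (filterᵇ (P ∘ f) xs)
length-filterᵇ-map P f []       = refl
length-filterᵇ-map P f (x ∷ xs) = begin
  length (filterᵇ P (f x ∷ map f xs))           ≡⟨ length-filterᵇ-∷ P (f x) (map f xs) ⟩
  bit (P (f x)) + length (filterᵇ P (map f xs)) ≡⟨ cong (bit (P (f x)) +_) (length-filterᵇ-map P f xs) ⟩
  bit (P (f x)) + length (filterᵇ (P ∘ f) xs)   ≡⟨ length-filterᵇ-∷ (P ∘ f) x xs ⟨
  length (filterᵇ (P ∘ f) (x ∷ xs))             ∎

filterᵇ-filterᵇ : ∀ (P Q : A → Bool) xs → filterᵇ P (filterᵇ Q xs) ≡ filterᵇ (λ a → Q a ∧ P a) xs
filterᵇ-filterᵇ P Q [] = refl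
filterᵇ-filterᵇ P Q (x ∷ xs) with Q x
... | false = filterᵇ-filterᵇ P Q xs
... | true with P x
...   | true  = cong (x ∷_) (filterᵇ-filterᵇ P Q xs)
...   | false = filterᵇ-filterᵇ P Q xs

countBelow : ℕ → (ℕ → Bool) → ℕ
countBelow zero    f = 0
countBelow (suc n) f = bit (f 0) + countBelow n (f ∘ suc)

countBelow-cong : ∀ n {f g : ℕ → Bool} → (∀ i → f i ≡ g i) → countBelow n f ≡ countBelow n g
countBelow-cong zero    f≗g = refl
countBelow-cong (suc n) f≗g = cong₂ _+_ (cong bit (f≗g 0)) (countBelow-cong n (f≗g ∘ suc))

countBelow-false : ∀ n → countBelow n (λ _ → false) ≡ 0
countBelow-false zero    = refl
countBelow-false (suc n) = countBelow-false n

length-filterᵇ-tabulate : ∀ {n} (P : A → Bool) (f : Fin n → A) (g : ℕ → Bool) →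
  (∀ i → P (f i) ≡ g (toℕ i)) → length (filterᵇ P (tabulate f)) ≡ countBelow n g
length-filterᵇ-tabulate {n = zero}  P f g P∘f≗g = refl
length-filterᵇ-tabulate {n = suc n} P f g P∘f≗g =
  trans (length-filterᵇ-∷ P (f Fin.zero) _) (cong₂ _+_
    (cong bit (P∘f≗g Fin.zero))
    (length-filterᵇ-tabulate P (f ∘ Fin.suc) (g ∘ suc) (P∘f≗g ∘ Fin.suc)))

-- Extended by false beyond the last vertex, so windows reaching past the end need no special case.
indicator : ∀ {V} → Subset V → ℕ → Bool
indicator []      v       = false
indicator (b ∷ S) zero    = b
indicator (b ∷ S) (suc v) = indicator S v

lookup-indicator : ∀ {V} (S : Subset V) i → lookup S i ≡ indicator S (toℕ i)
lookup-indicator (b ∷ S) Fin.zero    = refl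
lookup-indicator (b ∷ S) (Fin.suc i) = lookup-indicator S i

<ᵇ-suc : ∀ a b → (a <ᵇ suc b) ≡ (a ≤ᵇ b)
<ᵇ-suc zero    b = refl
<ᵇ-suc (suc a) b = refl

countBelow-interval : ∀ {V} (S : Subset V) a c →
  countBelow V (λ v → ((a ≤ᵇ v) ∧ (v ≤ᵇ a + c)) ∧ indicator S v) ≡ countBelow (suc c) (λ t → indicator S (a + t))
countBelow-interval         []      a       c       = sym (countBelow-false (suc c))
countBelow-interval {suc V} (b ∷ S) zero    zero    = cong (bit b +_) (countBelow-false V)
countBelow-interval {suc V} (b ∷ S) zero    (suc c) = cong (bit b +_) (trans
  (countBelow-cong V (λ v → cong (_∧ indicator S v) (<ᵇ-suc v c)))
  (countBelow-interval S zero c))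
countBelow-interval {suc V} (b ∷ S) (suc a) c       = trans
  (countBelow-cong V (λ v → cong (_∧ indicator S v) (cong₂ _∧_ (<ᵇ-suc a v) (<ᵇ-suc v (a + c)))))
  (countBelow-interval S a c)

countSubsets : (W : ℕ) → (Subset W → Bool) → ℕ
countSubsets W P = length (filterᵇ P (allSubsets W))

countSubsets-suc : ∀ W (P : Subset (suc W) → Bool) →
  countSubsets (suc W) P ≡ countSubsets W (λ S → P (true ∷ S)) + countSubsets W (λ S → P (false ∷ S))
countSubsets-suc W P = trans (length-filterᵇ-++ P (map (true ∷_) subsets) (map (false ∷_) subsets))
  (cong₂ _+_ (length-filterᵇ-map P (true ∷_) subsets) (length-filterᵇ-map P (false ∷_) subsets))
  where subsets = allSubsets W

countSubsets-cong : ∀ W {P Q : Subset W → Bool} → (∀ S → P S ≡ Q S) → countSubsets W P ≡ countSubsets W Q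
countSubsets-cong W {P} {Q} P≗Q = cong length
  (filter-≐ (T? ∘ P) (T? ∘ Q) ((λ {S} → subst T (P≗Q S)) , (λ {S} → subst T (sym (P≗Q S)))) (allSubsets W))

countSubsets-none : ∀ W {P : Subset W → Bool} → (∀ S → P S ≡ false) → countSubsets W P ≡ 0
countSubsets-none W {P} P≡false =
  cong length (filter-none (T? ∘ P) (All.universal (λ S → subst T (P≡false S)) (allSubsets W)))

countSubsets-∧-false : ∀ W (P : Subset W → Bool) → countSubsets W (λ S → P S ∧ false) ≡ 0
countSubsets-∧-false W P = countSubsets-none W (λ S → ∧-zeroʳ (P S))

module Hyperpath (m : ℕ) where

  pathIndependent : ℕ → (ℕ → Bool) → Bool
  pathIndependent zero    f = true
  pathIndependent (suc n) f = (countBelow (suc m) f ≤ᵇ 1) ∧ pathIndependent n (λ v → f (m + v))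

  windowCount : (ℕ → Bool) → ℕ → ℕ
  windowCount f i = countBelow (suc m) (λ t → f (i * m + t))

  windowCount-suc : ∀ f i → windowCount f (suc i) ≡ windowCount (λ v → f (m + v)) i
  windowCount-suc f i = countBelow-cong (suc m) (λ t → cong f (+-assoc m (i * m) t))

  all-windowCount≤1 : ∀ n f → all (λ i → windowCount f i ≤ᵇ 1) (upTo n) ≡ pathIndependent n f
  all-windowCount≤1 zero    f = refl
  all-windowCount≤1 (suc n) f = cong ((windowCount f 0 ≤ᵇ 1) ∧_) (begin
    and (map (λ i → windowCount f i ≤ᵇ 1) (applyUpTo suc n))   ≡⟨ cong and (map-applyUpTo suc _ n) ⟩
    and (applyUpTo (λ i → windowCount f (suc i) ≤ᵇ 1) n)       ≡⟨ cong and (map-applyUpTo (λ i → i) _ n) ⟨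
    all (λ i → windowCount f (suc i) ≤ᵇ 1) (upTo n)            ≡⟨ cong and (map-cong (λ i → cong (_≤ᵇ 1) (windowCount-suc f i)) (upTo n)) ⟩
    all (λ i → windowCount (λ v → f (m + v)) i ≤ᵇ 1) (upTo n)  ≡⟨ all-windowCount≤1 n (λ v → f (m + v)) ⟩
    pathIndependent n (λ v → f (m + v))                    ∎)

  countIn-edge : ∀ {V} (S : Subset V) i →
    countIn S (filterᵇ (λ v → inEdge (suc m) i (toℕ v)) (allFin V)) ≡ windowCount (indicator S) i
  countIn-edge {V} S i = begin
    length (filterᵇ (lookup S) (filterᵇ (λ v → inEdge (suc m) i (toℕ v)) (allFin V)))
      ≡⟨ cong length (filterᵇ-filterᵇ (lookup S) _ (allFin V)) ⟩
    length (filterᵇ (λ v → inEdge (suc m) i (toℕ v) ∧ lookup S v) (allFin V))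
      ≡⟨ length-filterᵇ-tabulate _ (λ v → v) _ (λ v → cong (inEdge (suc m) i (toℕ v) ∧_) (lookup-indicator S v)) ⟩
    countBelow V (λ v → inEdge (suc m) i v ∧ indicator S v)
      ≡⟨ countBelow-interval S (i * m) m ⟩
    windowCount (indicator S) i ∎

  isIndependent-hyperpath : ∀ n (S : Subset (pathVertices n (suc m))) →
    isIndependent (hyperpath n (suc m)) S ≡ pathIndependent n (indicator S)
  isIndependent-hyperpath n S = trans
    (cong and (trans (sym (map-∘ (upTo n))) (map-cong (λ i → cong (_≤ᵇ 1) (countIn-edge S i)) (upTo n))))
    (all-windowCount≤1 n (indicator S))

  pathVertices-suc : ∀ n → pathVertices (suc n) (suc m) ≡ suc (suc n * m)
  pathVertices-suc n = begin
    suc n * suc m ∸ n           ≡⟨ cong (_∸ n) (*-suc (suc n) m) ⟩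
    suc (n + suc n * m) ∸ n     ≡⟨ cong (_∸ n) (+-suc n (suc n * m)) ⟨
    n + suc (suc n * m) ∸ n     ≡⟨ m+n∸m≡n n _ ⟩
    suc (suc n * m)             ∎

-- pathCount n k counts the independent k-sets of a path of n edges of size x + 2, grown at its
-- first vertex; avoidCount n k those avoiding that vertex. A new first edge contributes either
-- one of its w private vertices (w = x + 1, resp. x when its first vertex is excluded), which
-- forces the old first vertex out, or none of them. For n = 0 the "path" is the single vertex
-- at which it grows, not the empty hypergraph P₀.
module Counts (x : ℕ) where

  pathCount avoidCount : ℕ → ℕ → ℕ
  admissibleCount : ℕ → ℕ → ℕ → ℕ

  pathCount zero    zero          = 1
  pathCount zero    (suc zero)    = 1
  pathCount zero    (suc (suc k)) = 0
  pathCount (suc n) k             = admissibleCount (suc x) n k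

  avoidCount zero    zero    = 1
  avoidCount zero    (suc k) = 0
  avoidCount (suc n) k       = admissibleCount x n k

  admissibleCount w n zero    = 1
  admissibleCount w n (suc k) = w * avoidCount n k + pathCount n (suc k)

  pathCount-zero : ∀ n → pathCount n 0 ≡ 1
  pathCount-zero zero    = refl
  pathCount-zero (suc n) = refl

  avoidCount-zero : ∀ n → avoidCount n 0 ≡ 1
  avoidCount-zero zero    = refl
  avoidCount-zero (suc n) = refl

  pathCount-one : ∀ n → pathCount n 1 ≡ suc (n * suc x)
  pathCount-one zero    = refl
  pathCount-one (suc n) = begin
    suc x * avoidCount n 0 + pathCount n 1 ≡⟨ cong₂ (λ a b → suc x * a + b) (avoidCount-zero n) (pathCount-one n) ⟩
    suc x * 1 + suc (n * suc x)            ≡⟨ shape x (n * suc x) ⟩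
    suc (suc n * suc x)                    ∎
    where
    shape : ∀ x y → suc x * 1 + suc y ≡ suc (suc x + y)
    shape = solve-∀

  pathCount-recurrence : ∀ n k →
    pathCount (suc (suc n)) (suc k) ≡ pathCount (suc n) (suc k) + pathCount n k + x * pathCount (suc n) k
  pathCount-recurrence n zero = begin
    suc x * 1 + a            ≡⟨ shape x a ⟩
    a + 1 + x * 1            ≡⟨ cong (λ b → a + b + x * 1) (pathCount-zero n) ⟨
    a + pathCount n 0 + x * 1 ∎
    where
    a = pathCount (suc n) 1
    shape : ∀ x a → suc x * 1 + a ≡ a + 1 + x * 1
    shape = solve-∀
  pathCount-recurrence n (suc k) = shape x (avoidCount n k) (pathCount n (suc k)) (pathCount (suc n) (suc (suc k)))
    where
    shape : ∀ x z a b → suc x * (x * z + a) + b ≡ b + a + x * (suc x * z + a)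
    shape = solve-∀

-- A set of vertices 0, …, w + n (x + 1) is admissible if it meets {0, …, w} at most once
-- (avoiding: never) and is independent in the path of n edges starting at vertex w.
-- Deleting vertex 0 turns each of these conditions into another one of them, so they can be
-- counted by splitting on the first bit of the subset.
module Transfer (x : ℕ) where
  open Hyperpath (suc x)
  open Counts x

  admissible avoiding : ℕ → ℕ → (ℕ → Bool) → Bool
  admissible w n f = (countBelow (suc w) f ≤ᵇ 1) ∧ pathIndependent n (λ v → f (w + v))
  avoiding   w n f = (countBelow (suc w) f <ᵇ 1) ∧ pathIndependent n (λ v → f (w + v))

  countSubsets-admissible : ∀ w n k →
    countSubsets (suc w + n * suc x) (λ S → admissible w n (indicator S) ∧ (size S ≡ᵇ k)) ≡ admissibleCount w n k
  countSubsets-avoiding : ∀ w n k →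
    countSubsets (suc w + n * suc x) (λ S → avoiding w n (indicator S) ∧ (size S ≡ᵇ k)) ≡ avoidCount n k

  countSubsets-admissible zero zero zero          = refl
  countSubsets-admissible zero zero (suc zero)    = refl
  countSubsets-admissible zero zero (suc (suc k)) = refl
  countSubsets-admissible zero (suc n) zero = trans (countSubsets-suc (suc x + n * suc x) _)
    (cong₂ _+_ (countSubsets-∧-false (suc x + n * suc x) _) (countSubsets-admissible x n zero))
  countSubsets-admissible zero (suc n) (suc k) = trans (countSubsets-suc (suc x + n * suc x) _) (trans
    (cong₂ _+_ (countSubsets-avoiding x n k) (countSubsets-admissible x n (suc k)))
    (sym (+-assoc (avoidCount n k) (x * avoidCount n k) _)))
  countSubsets-admissible (suc w) n zero = trans (countSubsets-suc (suc w + n * suc x) _)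
    (cong₂ _+_ (countSubsets-∧-false (suc w + n * suc x) _) (countSubsets-admissible w n zero))
  countSubsets-admissible (suc w) n (suc k) = trans (countSubsets-suc (suc w + n * suc x) _) (trans
    (cong₂ _+_ (countSubsets-avoiding w n k) (countSubsets-admissible w n (suc k)))
    (sym (+-assoc (avoidCount n k) (w * avoidCount n k) _)))

  countSubsets-avoiding zero zero zero    = refl
  countSubsets-avoiding zero zero (suc k) = refl
  countSubsets-avoiding zero (suc n) k = trans (countSubsets-suc (suc x + n * suc x) _)
    (cong₂ _+_ (countSubsets-none (suc x + n * suc x) (λ _ → refl)) (countSubsets-admissible x n k))
  countSubsets-avoiding (suc w) n k = trans (countSubsets-suc (suc w + n * suc x) _)
    (cong₂ _+_ (countSubsets-none (suc w + n * suc x) (λ _ → refl)) (countSubsets-avoiding w n k))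

  p≡pathCount : ∀ n k → p k (suc n) (suc (suc x)) ≡ pathCount (suc n) k
  p≡pathCount n k = begin
    countSubsets (pathVertices (suc n) ℓ) (λ S → isIndependent (hyperpath (suc n) ℓ) S ∧ (size S ≡ᵇ k))
      ≡⟨ countSubsets-cong _ (λ S → cong (_∧ (size S ≡ᵇ k)) (isIndependent-hyperpath (suc n) S)) ⟩
    countSubsets (pathVertices (suc n) ℓ) (λ S → pathIndependent (suc n) (indicator S) ∧ (size S ≡ᵇ k))
      ≡⟨ cong (λ V → countSubsets V (λ S → pathIndependent (suc n) (indicator S) ∧ (size S ≡ᵇ k))) (pathVertices-suc n) ⟩
    countSubsets (suc (suc n * suc x)) (λ S → pathIndependent (suc n) (indicator S) ∧ (size S ≡ᵇ k))
      ≡⟨ countSubsets-admissible (suc x) n k ⟩ -- pathIndependent (suc n) is admissible (suc x) n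
    pathCount (suc n) k ∎
    where ℓ = suc (suc x)

∑-last : ∀ n (f : ℕ → ℕ) → ∑[ i < suc n ] f (toℕ i) ≡ ∑[ i < n ] f (toℕ i) + f n
∑-last n f = trans (sum-init-last {n} (f ∘ toℕ))
  (cong₂ _+_ (sum-cong-≗ {n} (cong f ∘ toℕ-inject₁)) (cong f (toℕ-fromℕ n)))

sum-map-applyUpTo : ∀ n (f : ℕ → ℕ) (g : ℕ → ℕ) → sum (map g (applyUpTo f n)) ≡ ∑[ i < n ] g (f (toℕ i))
sum-map-applyUpTo zero    f g = refl
sum-map-applyUpTo (suc n) f g = cong (g (f 0) +_) (sum-map-applyUpTo n (f ∘ suc) g)

binomialSum : ℕ → ℕ → (ℕ → ℕ) → ℕ
binomialSum x r h = ∑[ j ≤ r ] (x ^ (r ∸ toℕ j) * (r C toℕ j) * h (toℕ j))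

-- Pascal's rule splits the sum for r + 1 into the sum for r applied to h ∘ suc and x times the
-- sum for r; the term that does not fit the latter carries the vanishing coefficient C(r, r + 1).
binomialSum-suc : ∀ x r h → binomialSum x (suc r) h ≡ x * binomialSum x r h + binomialSum x r (h ∘ suc)
binomialSum-suc x r h = begin
  head + ∑[ i ≤ r ] (x ^ (r ∸ toℕ i) * (suc r C suc (toℕ i)) * h (suc (toℕ i)))
    ≡⟨ cong (head +_) (sum-cong-≗ {suc r} (λ i → pascal (toℕ i))) ⟩
  head + ∑[ i ≤ r ] (lower (toℕ i) + upper (toℕ i))
    ≡⟨ cong (head +_) (∑-distrib-+ {suc r} (lower ∘ toℕ) (upper ∘ toℕ)) ⟩
  head + (binomialSum x r (h ∘ suc) + ∑[ i ≤ r ] upper (toℕ i))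
    ≡⟨ cong (λ s → head + (binomialSum x r (h ∘ suc) + s)) upper-sum ⟩
  head + (binomialSum x r (h ∘ suc) + x * (∑[ i < r ] shifted (toℕ i)))
    ≡⟨ shape x (x ^ r) (h 0) (binomialSum x r (h ∘ suc)) (∑[ i < r ] shifted (toℕ i)) ⟩
  x * binomialSum x r h + binomialSum x r (h ∘ suc) ∎
  where
  head = x ^ suc r * (suc r C 0) * h 0
  lower upper shifted : ℕ → ℕ
  lower   j = x ^ (r ∸ j) * (r C j) * h (suc j)
  upper   j = x ^ (r ∸ j) * (r C suc j) * h (suc j)
  shifted j = x ^ (r ∸ suc j) * (r C suc j) * h (suc j)

  pascal : ∀ j → x ^ (r ∸ j) * (suc r C suc j) * h (suc j) ≡ lower j + upper j
  pascal j = trans (cong (λ c → x ^ (r ∸ j) * c * h (suc j)) (sym (nCk+nC[k+1]≡[n+1]C[k+1] r j)))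
    (distrib (x ^ (r ∸ j)) (r C j) (r C suc j) (h (suc j)))
    where
    distrib : ∀ a b c d → a * (b + c) * d ≡ a * b * d + a * c * d
    distrib = solve-∀

  upper-last : upper r ≡ 0
  upper-last = trans (cong (λ c → x ^ (r ∸ r) * c * h (suc r)) (k>n⇒nCk≡0 (n<1+n r)))
    (cong (_* h (suc r)) (*-zeroʳ (x ^ (r ∸ r))))

  upper-shifted : ∀ {j} → j < r → upper j ≡ x * shifted j
  upper-shifted {j} j<r = trans (cong (λ e → x ^ e * (r C suc j) * h (suc j)) (+-∸-assoc 1 j<r))
    (assoc x (x ^ (r ∸ suc j)) (r C suc j) (h (suc j)))
    where
    assoc : ∀ a b c d → a * b * c * d ≡ a * (b * c * d)
    assoc = solve-∀

  upper-sum : ∑[ i ≤ r ] upper (toℕ i) ≡ x * (∑[ i < r ] shifted (toℕ i))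
  upper-sum = begin
    ∑[ i ≤ r ] upper (toℕ i)          ≡⟨ ∑-last r upper ⟩
    ∑[ i < r ] upper (toℕ i) + upper r    ≡⟨ cong (∑[ i < r ] upper (toℕ i) +_) upper-last ⟩
    ∑[ i < r ] upper (toℕ i) + 0          ≡⟨ +-identityʳ _ ⟩
    ∑[ i < r ] upper (toℕ i)              ≡⟨ sum-cong-≗ {r} (λ i → upper-shifted (toℕ<n i)) ⟩
    ∑[ i < r ] (x * shifted (toℕ i))       ≡⟨ *-distribˡ-sum {r} x (shifted ∘ toℕ) ⟨
    x * (∑[ i < r ] shifted (toℕ i))        ∎

  -- the factors 1 are r C 0 and suc r C 0, which reduce to 1
  shape : ∀ x p h₀ s t → x * p * 1 * h₀ + (s + x * t) ≡ x * (p * 1 * h₀ + t) + s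
  shape = solve-∀

module ClosedForm (x : ℕ) where
  open Counts x

  closedSum : ℕ → ℕ → ℕ → ℕ
  closedSum r N K = binomialSum x r (λ j → (N ∸ j) C K)

  closedSum-base : ∀ N K → closedSum 0 N K ≡ N C K
  closedSum-base N K = trans (+-identityʳ _) (*-identityˡ (N C K))

  closedSum-suc : ∀ r N K → closedSum (suc r) (suc N) K ≡ x * closedSum r (suc N) K + closedSum r N K
  closedSum-suc r N K = binomialSum-suc x r (λ j → (suc N ∸ j) C K)

  closedSum-empty : ∀ r K → closedSum r 0 (suc K) ≡ 0
  closedSum-empty r K = trans (sum-cong-≗ {suc r} (λ i → vanish (toℕ i))) (sum-replicate-zero (suc r))
    where
    vanish : ∀ j → x ^ (r ∸ j) * (r C j) * ((0 ∸ j) C suc K) ≡ 0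
    vanish j = trans (cong (λ n → x ^ (r ∸ j) * (r C j) * (n C suc K)) (0∸n≡0 j)) (*-zeroʳ (x ^ (r ∸ j) * (r C j)))

  ∸-pascal : ∀ N j K → (suc N ∸ j) C suc (suc K) ≡ (N ∸ j) C suc (suc K) + (N ∸ j) C suc K
  ∸-pascal N       zero    K = trans (sym (nCk+nC[k+1]≡[n+1]C[k+1] N (suc K))) (+-comm (N C suc K) (N C suc (suc K)))
  ∸-pascal zero    (suc j) K = cong (_C suc (suc K)) (0∸n≡0 j)
  ∸-pascal (suc N) (suc j) K = ∸-pascal N j K

  closedSum-pascal : ∀ r N K →
    closedSum r (suc N) (suc (suc K)) ≡ closedSum r N (suc (suc K)) + closedSum r N (suc K)
  closedSum-pascal r N K = trans
    (sum-cong-≗ {suc r} (λ i → trans (cong (c (toℕ i) *_) (∸-pascal N (toℕ i) K)) (*-distribˡ-+ (c (toℕ i)) ((N ∸ toℕ i) C suc (suc K)) ((N ∸ toℕ i) C suc K))))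
    (∑-distrib-+ {suc r} (λ i → c (toℕ i) * ((N ∸ toℕ i) C suc (suc K))) (λ i → c (toℕ i) * ((N ∸ toℕ i) C suc K)))
    where
    c : ℕ → ℕ
    c j = x ^ (r ∸ j) * (r C j)

  pathCount-closed  : ∀ n k → pathCount n (suc (suc k)) ≡ suc x * suc x * closedSum k n (suc (suc k))
  avoidCount-closed : ∀ n k → avoidCount n (suc k) ≡ suc x * closedSum k n (suc k)

  pathCount-closed zero k =
    sym (trans (cong (suc x * suc x *_) (closedSum-empty k (suc k))) (*-zeroʳ (suc x * suc x)))
  pathCount-closed (suc n) k = begin
    suc x * avoidCount n (suc k) + pathCount n (suc (suc k))
      ≡⟨ cong₂ (λ a b → suc x * a + b) (avoidCount-closed n k) (pathCount-closed n k) ⟩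
    suc x * (suc x * closedSum k n (suc k)) + suc x * suc x * closedSum k n (suc (suc k))
      ≡⟨ shape (suc x) (closedSum k n (suc k)) (closedSum k n (suc (suc k))) ⟩
    suc x * suc x * (closedSum k n (suc (suc k)) + closedSum k n (suc k))
      ≡⟨ cong (suc x * suc x *_) (closedSum-pascal k n k) ⟨
    suc x * suc x * closedSum k (suc n) (suc (suc k)) ∎
    where
    shape : ∀ y a₁ a₂ → y * (y * a₁) + y * y * a₂ ≡ y * y * (a₂ + a₁)
    shape = solve-∀

  avoidCount-closed zero k = sym (trans (cong (suc x *_) (closedSum-empty k k)) (*-zeroʳ (suc x)))
  avoidCount-closed (suc n) zero = begin
    x * avoidCount n 0 + pathCount n 1  ≡⟨ cong₂ (λ a b → x * a + b) (avoidCount-zero n) (pathCount-one n) ⟩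
    x * 1 + suc (n * suc x)             ≡⟨ shape x n ⟩
    suc x * suc n                       ≡⟨ cong (suc x *_) (trans (closedSum-base (suc n) 1) (nC1≡n (suc n))) ⟨
    suc x * closedSum 0 (suc n) 1       ∎
    where
    shape : ∀ x n → x * 1 + suc (n * suc x) ≡ suc x * suc n
    shape = solve-∀
  avoidCount-closed (suc n) (suc k) = begin
    x * avoidCount n (suc k) + pathCount n (suc (suc k))
      ≡⟨ cong₂ (λ a b → x * a + b) (avoidCount-closed n k) (pathCount-closed n k) ⟩
    x * (suc x * a₁) + suc x * suc x * a₂
      ≡⟨ shape x a₁ a₂ ⟩
    suc x * (x * (a₂ + a₁) + a₂)
      ≡⟨ cong (λ s → suc x * (x * s + a₂)) (closedSum-pascal k n k) ⟨
    suc x * (x * closedSum k (suc n) (suc (suc k)) + a₂)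
      ≡⟨ cong (suc x *_) (closedSum-suc k n (suc (suc k))) ⟨
    suc x * closedSum (suc k) (suc n) (suc (suc k)) ∎
    where
    a₁ = closedSum k n (suc k)
    a₂ = closedSum k n (suc (suc k))
    shape : ∀ x a₁ a₂ → x * (suc x * a₁) + suc x * suc x * a₂ ≡ suc x * (x * (a₂ + a₁) + a₂)
    shape = solve-∀

  formulaSum-closedSum : ∀ N k → formulaSum N (suc (suc k)) (suc (suc x)) ≡ closedSum k N (suc (suc k))
  formulaSum-closedSum N k = trans (sum-map-applyUpTo (suc k) (λ j → j) _)
    (sum-cong-≗ {suc k} (λ i → cong (λ e → x ^ e * (k C toℕ i) * ((N ∸ toℕ i) C suc (suc k))) (exponent (toℕ i))))
    where
    exponent : ∀ j → suc (suc k) ∸ j ∸ 2 ≡ k ∸ j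
    exponent j = trans (∸-+-assoc (suc (suc k)) j 2) (cong (suc (suc k) ∸_) (+-comm j 2))

module IndependentSetCounts (x : ℕ) where
  open Hyperpath (suc x)
  open Counts x
  open Transfer x
  open ClosedForm x

  ℓ : ℕ
  ℓ = suc (suc x)

  p-singletons : ∀ n → p 1 (suc n) ℓ ≡ pathVertices (suc n) ℓ
  p-singletons n = trans (p≡pathCount n 1) (trans (pathCount-one (suc n)) (sym (pathVertices-suc n)))

  p-oneEdge : ∀ k → p (suc (suc k)) 1 ℓ ≡ 0
  p-oneEdge k = trans (p≡pathCount 0 (suc (suc k))) (trans (+-identityʳ _) (*-zeroʳ (suc x)))

  p-closed : ∀ n k → p (suc (suc k)) (suc n) ℓ ≡ suc x * suc x * formulaSum (suc n) (suc (suc k)) ℓ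
  p-closed n k = begin
    p (suc (suc k)) (suc n) ℓ                            ≡⟨ p≡pathCount n (suc (suc k)) ⟩
    pathCount (suc n) (suc (suc k))                      ≡⟨ pathCount-closed (suc n) k ⟩
    suc x * suc x * closedSum k (suc n) (suc (suc k))    ≡⟨ cong (suc x * suc x *_) (formulaSum-closedSum (suc n) k) ⟨
    suc x * suc x * formulaSum (suc n) (suc (suc k)) ℓ   ∎

  p-recurrence : ∀ n k → p (suc k) (3 + n) ℓ ≡ p (suc k) (2 + n) ℓ + p k (suc n) ℓ + x * p k (2 + n) ℓ
  p-recurrence n k = begin
    p (suc k) (3 + n) ℓ                                     ≡⟨ p≡pathCount (2 + n) (suc k) ⟩
    pathCount (3 + n) (suc k)                               ≡⟨ pathCount-recurrence (suc n) k ⟩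
    pathCount (2 + n) (suc k) + pathCount (suc n) k + x * pathCount (2 + n) k
      ≡⟨ cong₂ _+_ (cong₂ _+_ (p≡pathCount (suc n) (suc k)) (p≡pathCount n k)) (cong (x *_) (p≡pathCount (suc n) k)) ⟨
    p (suc k) (2 + n) ℓ + p k (suc n) ℓ + x * p k (2 + n) ℓ ∎

theorem1p2 : (ℓ : ℕ) → ℓ ≥ 2 →
      (p 0 0 ℓ ≡ 1 × (∀ k → k > 0 → p k 0 ℓ ≡ 0))
    × (p 0 1 ℓ ≡ 1 × p 1 1 ℓ ≡ ℓ × (∀ k → k ≥ 2 → p k 1 ℓ ≡ 0))
    × (∀ n → p 0 n ℓ ≡ 1)
    × (p 1 0 ℓ ≡ 0 × (∀ n → n > 0 → p 1 n ℓ ≡ n * ℓ ∸ (n ∸ 1)))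
    × (∀ n k → n ≥ 2 → k ≥ 2 → p k n ℓ ≡ (ℓ ∸ 1) * (ℓ ∸ 1) * formulaSum n k ℓ)
    × (∀ n k → n ≥ 3 → k ≥ 1 →
         p k n ℓ ≡ p k (n ∸ 1) ℓ + p (k ∸ 1) (n ∸ 2) ℓ + (ℓ ∸ 2) * p (k ∸ 1) (n ∸ 1) ℓ)
theorem1p2 (suc zero) (s≤s ())
theorem1p2 (suc (suc x)) _ =
    (refl , λ { (suc k) _ → refl })
  , (p≡pathCount 0 0 , trans (p-singletons 0) (+-identityʳ ℓ) , λ { (suc (suc k)) _ → p-oneEdge k ; (suc zero) (s≤s ()) })
  , (λ { zero → refl ; (suc n) → p≡pathCount n 0 })
  , (refl , λ { (suc n) _ → p-singletons n })
  , (λ { (suc n) (suc (suc k)) _ _ → p-closed n k ; _ (suc zero) _ (s≤s ()) })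
  , (λ { (suc (suc (suc n))) (suc k) _ _ → p-recurrence n k
      ; (suc zero) _ (s≤s ()) _ ; (suc (suc zero)) _ (s≤s (s≤s ())) _ })
  where
  open Transfer x
  open IndependentSetCounts x
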